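{- For every integer $\ell\ge 3$, the diameter of the cyclic Kautz digraph $CK(3,\ell)$ is at most $2\ell-1$.
   Context: $CK(d,\ell)$ has as vertices all words $a_1\ldots a_\ell$ over an alphabet of $d+1$ symbols with $a_i\ne a_{i+1}$ for $1\le i\le\ell-1$ and $a_1\ne a_\ell$, and an arc from $a_1a_2\ldots a_\ell$ to $a_2\ldots a_\ell a_{\ell+1}$ whenever both words are vertices. The diameter is the maximum over ordered pairs of vertices of the directed distance. -}

module Defs where

open import Data.Nat using (ℕ; zero; suc; _≤_)
open import Data.Fin using (Fin)
open import Data.Vec using (Vec; []; _∷_; _∷ʳ_; head; last)
open import Data.Product using (Σ; _×_; ∃-syntax)
open import Relation.Binary.PropositionalEquality using (_≡_; _≢_)

Word : ℕ → ℕ → Set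
Word d ℓ = Vec (Fin (suc d)) ℓ

data NoRepeat {d : ℕ} : {ℓ : ℕ} → Word d ℓ → Set where
  nr-[] : NoRepeat []
  nr-[x] : ∀ {a} → NoRepeat (a ∷ [])
  nr-∷ : ∀ {ℓ a b} {w : Word d ℓ} →
         a ≢ b → NoRepeat (b ∷ w) → NoRepeat (a ∷ b ∷ w)

IsVertex : (d ℓ : ℕ) → Word d (suc ℓ) → Set
IsVertex d ℓ w = NoRepeat w × head w ≢ last w

Arc : (d ℓ : ℕ) → Word d (suc ℓ) → Word d (suc ℓ) → Set
Arc d ℓ u v = IsVertex d ℓ u × IsVertex d ℓ v ×
  Σ (Fin (suc d)) λ a → Σ (Word d ℓ) λ w → Σ (Fin (suc d)) λ b →
    (u ≡ a ∷ w) × (v ≡ w ∷ʳ b)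

data Walk (d ℓ : ℕ) : ℕ → Word d (suc ℓ) → Word d (suc ℓ) → Set where
  here  : ∀ {u} → Walk d ℓ zero u u
  step  : ∀ {k u v w} → Arc d ℓ u v → Walk d ℓ k v w → Walk d ℓ (suc k) u w

DistLe : (d ℓ : ℕ) → Word d (suc ℓ) → Word d (suc ℓ) → ℕ → Set
DistLe d ℓ u v D = ∃[ k ] (k ≤ D × Walk d ℓ k u v)

DiameterLe : (d ℓ : ℕ) → ℕ → Set
DiameterLe d ℓ D = ∀ (u v : Word d (suc ℓ)) →
  IsVertex d ℓ u → IsVertex d ℓ v → DistLe d ℓ u v D

-- A walk from u to v is a word u ++ c ++ v all of whose windows of length ℓ are vertices; we
-- find such c with |c| ≤ ℓ − 1. Each symbol of c must avoid its predecessor and the two symbols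
-- ℓ − 1 positions away (one in u, one in v), and c must end before head v. With four symbols,
-- once some position has two admissible values the rest can always be completed, since every
-- later position again has two fresh values, one of which differs from the chosen predecessor.
-- Such slack is found at the first or second position, possibly after shortening c by one.
module Submission where

open import Defs
open import Data.Nat using (ℕ; zero; suc; _≤_; _+_; _∸_; _*_; s≤s)
open import Data.Nat.Properties using (≤-refl; ≤-reflexive; n≤1+n; +-identityʳ; +-comm; +-monoˡ-≤)
open import Data.Fin using (Fin)
open import Data.Fin.Properties using (_≟_; all?; any?)
open import Data.List using (List; []; _∷_; _++_; [_]; length; drop; zip)
open import Data.List.Properties using (++-assoc; ++-identityʳ; length-++; drop-all)
open import Data.List.Relation.Unary.All using (All; []; _∷_)
open import Data.List.Relation.Unary.Linked using (Linked; []; [-]; _∷_)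
open import Data.Vec using (Vec; []; _∷_; _∷ʳ_; head; tail; last; toList)
open import Data.Vec.Properties using (toList-∷ʳ; last-∷ʳ; length-toList; toList-injective)
open import Data.Vec.Relation.Binary.Equality.Cast using (cast-is-id)
open import Data.Product using (∃-syntax; _×_; _,_; uncurry)
open import Data.Sum using (_⊎_; inj₁; inj₂)
open import Data.Empty using (⊥-elim)
open import Function using (_∘_)
open import Relation.Nullary using (Dec; yes; no; ¬?)
open import Relation.Nullary.Decidable using (toWitness; _×-dec_; _⊎-dec_)
open import Relation.Binary.PropositionalEquality using (_≡_; _≢_; ≢-sym; refl; sym; trans; cong; subst; subst₂; module ≡-Reasoning)

module _ {A : Set} where

  Apart : List A → List A → Set
  Apart xs ys = All (uncurry _≢_) (zip xs ys)

  Apart-[]ʳ : ∀ xs → Apart xs []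
  Apart-[]ʳ []      = []
  Apart-[]ʳ (_ ∷ _) = []

  Apart-sym : ∀ xs ys → Apart xs ys → Apart ys xs
  Apart-sym []       []       _           = []
  Apart-sym []       (_ ∷ _)  _           = []
  Apart-sym (_ ∷ _)  []       _           = []
  Apart-sym (_ ∷ xs) (_ ∷ ys) (x≢y ∷ ap) = ≢-sym x≢y ∷ Apart-sym xs ys ap

  Apart-++ˡ : ∀ xs {ys zs} → Apart xs zs → Apart ys (drop (length xs) zs) → Apart (xs ++ ys) zs
  Apart-++ˡ []                   _          ap′ = ap′
  Apart-++ˡ (_ ∷ _)  {zs = []}    _          _   = []
  Apart-++ˡ (_ ∷ xs) {zs = _ ∷ _} (x≢z ∷ ap) ap′ = x≢z ∷ Apart-++ˡ xs ap ap′

  Apart-++ʳ : ∀ {xs} ys {zs} → Apart xs ys → Apart (drop (length ys) xs) zs → Apart xs (ys ++ zs)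
  Apart-++ʳ         []       _          ap′ = ap′
  Apart-++ʳ {[]}    (_ ∷ _)  _          _   = []
  Apart-++ʳ {_ ∷ _} (_ ∷ ys) (x≢y ∷ ap) ap′ = x≢y ∷ Apart-++ʳ ys ap ap′

  drop-++ : ∀ (xs ys : List A) {n m} → length xs + n ≡ m → drop m (xs ++ ys) ≡ drop n ys
  drop-++ []       ys refl = refl
  drop-++ (_ ∷ xs) ys refl = drop-++ xs ys refl

  Linked-splice : ∀ {R : A → A → Set} xs {z ys} →
                  Linked R (xs ++ [ z ]) → Linked R (z ∷ ys) → Linked R (xs ++ z ∷ ys)
  Linked-splice []           _         lz = lz
  Linked-splice (_ ∷ [])     (r ∷ _)   lz = r ∷ lz
  Linked-splice (_ ∷ y ∷ xs) (r ∷ lk)  lz = r ∷ Linked-splice (y ∷ xs) lk lz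

  drop-toList : ∀ {n} (w : Vec A (suc n)) → drop n (toList w) ≡ [ last w ]
  drop-toList {zero}  (_ ∷ []) = refl
  drop-toList {suc n} (_ ∷ w)  = drop-toList w

  ≤-length-toList : ∀ {m n} (w : Vec A n) → m ≤ n → m ≤ length (toList w)
  ≤-length-toList w = subst (_ ≤_) (sym (length-toList w))

NoRepeat⇒Linked : ∀ {d n} {w : Word d n} → NoRepeat w → Linked _≢_ (toList w)
NoRepeat⇒Linked nr-[]        = []
NoRepeat⇒Linked nr-[x]       = [-]
NoRepeat⇒Linked (nr-∷ a≢b nr) = a≢b ∷ NoRepeat⇒Linked nr

NoRepeat-∷ʳ : ∀ {d n r} {w : Word d (suc n)} → NoRepeat w → last w ≢ r → NoRepeat (w ∷ʳ r)
NoRepeat-∷ʳ {w = _ ∷ []}    nr-[x]        w≢r = nr-∷ w≢r nr-[x]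
NoRepeat-∷ʳ {w = _ ∷ _ ∷ _} (nr-∷ a≢b nr) w≢r = nr-∷ a≢b (NoRepeat-∷ʳ nr w≢r)

module _ {A : Set} where

  slide : ∀ {n} → Vec A (suc n) → List A → Vec A (suc n)
  slide u       []      = u
  slide (a ∷ w) (r ∷ R) = slide (w ∷ʳ r) R

  slide-++ : ∀ {n} (u : Vec A (suc n)) R R′ → slide u (R ++ R′) ≡ slide (slide u R) R′
  slide-++ u       []      R′ = refl
  slide-++ (a ∷ w) (r ∷ R) R′ = slide-++ (w ∷ʳ r) R R′

  toList-slide : ∀ {n} (u : Vec A (suc n)) R → toList (slide u R) ≡ drop (length R) (toList u ++ R)
  toList-slide u       []      = sym (++-identityʳ (toList u))
  toList-slide (a ∷ w) (r ∷ R) = begin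
    toList (slide (w ∷ʳ r) R)              ≡⟨ toList-slide (w ∷ʳ r) R ⟩
    drop (length R) (toList (w ∷ʳ r) ++ R) ≡⟨ cong (λ xs → drop (length R) (xs ++ R)) (toList-∷ʳ r w) ⟩
    drop (length R) ((toList w ++ [ r ]) ++ R) ≡⟨ cong (drop (length R)) (++-assoc (toList w) [ r ] R) ⟩
    drop (length R) (toList w ++ r ∷ R)    ∎
    where open ≡-Reasoning

  slide-toList : ∀ {n} (w v : Vec A (suc n)) → slide w (toList v) ≡ v
  slide-toList w v = trans (sym (cast-is-id refl (slide w (toList v))))
    (toList-injective refl (slide w (toList v)) v (trans (toList-slide w (toList v))
      (drop-++ (toList w) (toList v) (trans (+-identityʳ _) (trans (length-toList w) (sym (length-toList v)))))))

  slide-onto : ∀ {n} (u v : Vec A (suc n)) c → slide u (c ++ toList v) ≡ v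
  slide-onto u v c = trans (slide-++ u c (toList v)) (slide-toList (slide u c) v)

  -- Every window of length n+1 of u ++ R is then a cyclic Kautz word: consecutive symbols differ,
  -- and so do symbols n apart (the pair inside u itself is u's own vertex condition).
  Admissible : ∀ {n} → Vec A (suc n) → List A → Set
  Admissible u R = Linked _≢_ (last u ∷ R) × Apart (toList (tail u) ++ R) R

  Connector : ∀ {n} → Vec A (suc n) → Vec A (suc n) → Set
  Connector {n} u v = ∃[ c ] (length c ≤ n × Admissible u (c ++ toList v))

walk-slide : ∀ {d L} (u : Word d (suc L)) R → IsVertex d L u → Admissible u R →
             Walk d L (length R) u (slide u R)
walk-slide u []      _ _ = here
walk-slide (a ∷ []) (_ ∷ _) (_ , a≢a) _ = ⊥-elim (a≢a refl)
walk-slide (a ∷ b ∷ w) (r ∷ R) iu@(nr-∷ _ nr , _) (w≢r ∷ lk , b≢r ∷ ap) =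
  step (iu , iu′ , a , b ∷ w , r , refl , refl) (walk-slide ((b ∷ w) ∷ʳ r) R iu′ (lk′ , ap′))
  where
  r-last : last ((b ∷ w) ∷ʳ r) ≡ r
  r-last = last-∷ʳ r (b ∷ w)
  iu′ : IsVertex _ _ ((b ∷ w) ∷ʳ r)
  iu′ = NoRepeat-∷ʳ nr w≢r , λ b≡ → b≢r (trans b≡ r-last)
  lk′ : Linked _≢_ (last ((b ∷ w) ∷ʳ r) ∷ R)
  lk′ = subst (λ x → Linked _≢_ (x ∷ R)) (sym r-last) lk
  ap′ : Apart (toList (w ∷ʳ r) ++ R) R
  ap′ = subst (λ xs → Apart xs R)
          (sym (trans (cong (_++ R) (toList-∷ʳ r w)) (++-assoc (toList w) [ r ] R))) ap

connector⇒DistLe : ∀ {d L} {u v : Word d (suc L)} → IsVertex d L u → Connector u v →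
                   DistLe d L u v (2 * suc L ∸ 1)
connector⇒DistLe {d} {L} {u} {v} iu (c , c≤L , adm) =
  length (c ++ toList v) , bound , subst (Walk d L _ u) (slide-onto u v c) (walk-slide u _ iu adm)
  where
  bound : length (c ++ toList v) ≤ 2 * suc L ∸ 1
  bound = subst₂ _≤_
            (sym (trans (length-++ c) (cong (length c +_) (length-toList v))))
            (cong (L +_) (sym (+-identityʳ (suc L))))
            (+-monoˡ-≤ (suc L) c≤L)

Sym : Set
Sym = Fin 4

-- Opaque, so that case analysis on its result never unfolds the exhaustive search.
opaque
  avoid₃ : (x y z : Sym) → ∃[ e ] (e ≢ x × e ≢ y × e ≢ z)
  avoid₃ = toWitness {a? = all? λ x → all? λ y → all? λ z →
                             any? λ e → ¬? (e ≟ x) ×-dec ¬? (e ≟ y) ×-dec ¬? (e ≟ z)} _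

avoid₂ : (x y : Sym) → ∃[ e ] ∃[ e′ ] (e ≢ e′ × (e ≢ x × e ≢ y) × (e′ ≢ x × e′ ≢ y))
avoid₂ x y with avoid₃ x y x
... | e , e≢x , e≢y , _ with avoid₃ x y e
...   | e′ , e′≢x , e′≢y , e′≢e = e , e′ , ≢-sym e′≢e , (e≢x , e≢y) , (e′≢x , e′≢y)

Collision : Sym → Sym → Sym → Set
Collision x y z = x ≡ y ⊎ x ≡ z ⊎ y ≡ z

collision? : ∀ x y z → Dec (Collision x y z)
collision? x y z = x ≟ y ⊎-dec x ≟ z ⊎-dec y ≟ z

Fresh : Sym → Sym → Sym → Sym → Set
Fresh e x y z = e ≢ x × e ≢ y × e ≢ z

fresh-pair : ∀ {x y z} → Collision x y z → ∃[ e ] ∃[ e′ ] (e ≢ e′ × Fresh e x y z × Fresh e′ x y z)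
fresh-pair {x} {y} {z} (inj₁ refl) with avoid₂ x z
... | e , e′ , e≢e′ , (e≢x , e≢z) , (e′≢x , e′≢z) = e , e′ , e≢e′ , (e≢x , e≢x , e≢z) , (e′≢x , e′≢x , e′≢z)
fresh-pair {x} {y} {z} (inj₂ (inj₁ refl)) with avoid₂ x y
... | e , e′ , e≢e′ , (e≢x , e≢y) , (e′≢x , e′≢y) = e , e′ , e≢e′ , (e≢x , e≢y , e≢x) , (e′≢x , e′≢y , e′≢x)
fresh-pair {x} {y} {z} (inj₂ (inj₂ refl)) with avoid₂ x y
... | e , e′ , e≢e′ , (e≢x , e≢y) , (e′≢x , e′≢y) = e , e′ , e≢e′ , (e≢x , e≢y , e≢y) , (e′≢x , e′≢y , e′≢y)

-- Between u and v: s = last u, z = head v, and P, Q hold the symbols of u and of v lying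
-- ℓ − 1 positions before and after each position of the word.
record Bridge (m : ℕ) (s : Sym) (P Q : List Sym) (z : Sym) : Set where
  constructor bridge
  field
    word        : List Sym
    length-word : length word ≡ m
    linked      : Linked _≢_ (s ∷ word ++ [ z ])
    apart-P     : Apart word P
    apart-Q     : Apart word Q

bridge-∷ : ∀ {m s e p q P Q z} → e ≢ s → e ≢ p → e ≢ q → Bridge m e P Q z →
           Bridge (suc m) s (p ∷ P) (q ∷ Q) z
bridge-∷ e≢s e≢p e≢q (bridge c len lk aP aQ) =
  bridge (_ ∷ c) (cong suc len) (≢-sym e≢s ∷ lk) (e≢p ∷ aP) (e≢q ∷ aQ)

bridge-∷-either : ∀ {m a a′ e p q P Q z} → a ≢ a′ → e ≢ p → e ≢ q → Bridge m e P Q z →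
                  Bridge (suc m) a (p ∷ P) (q ∷ Q) z ⊎ Bridge (suc m) a′ (p ∷ P) (q ∷ Q) z
bridge-∷-either {a = a} {e = e} a≢a′ e≢p e≢q b with e ≟ a
... | yes refl = inj₂ (bridge-∷ a≢a′ e≢p e≢q b)
... | no e≢a   = inj₁ (bridge-∷ e≢a e≢p e≢q b)

bridge-either : ∀ {a a′} m P Q z → a ≢ a′ → m ≤ length P → m ≤ length Q →
                Bridge m a P Q z ⊎ Bridge m a′ P Q z
bridge-either {a} zero P Q z a≢a′ _ _ with a ≟ z
... | yes refl = inj₂ (bridge [] refl (≢-sym a≢a′ ∷ [-]) [] [])
... | no a≢z   = inj₁ (bridge [] refl (a≢z ∷ [-]) [] [])
bridge-either (suc m) (p ∷ P) (q ∷ Q) z a≢a′ (s≤s m≤P) (s≤s m≤Q) with avoid₂ p q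
... | e , e′ , e≢e′ , (e≢p , e≢q) , (e′≢p , e′≢q) with bridge-either m P Q z e≢e′ m≤P m≤Q
...   | inj₁ b = bridge-∷-either a≢a′ e≢p e≢q b
...   | inj₂ b = bridge-∷-either a≢a′ e′≢p e′≢q b

bridge-slack : ∀ {m s p q P Q z} → Collision s p q → m ≤ length P → m ≤ length Q →
               Bridge (suc m) s (p ∷ P) (q ∷ Q) z
bridge-slack {m} {P = P} {Q} {z} col m≤P m≤Q with fresh-pair col
... | e , e′ , e≢e′ , (e≢s , e≢p , e≢q) , (e′≢s , e′≢p , e′≢q) with bridge-either m P Q z e≢e′ m≤P m≤Q
...   | inj₁ b = bridge-∷ e≢s e≢p e≢q b
...   | inj₂ b = bridge-∷ e′≢s e′≢p e′≢q b

connector-long : ∀ {L} {u v : Word 3 (suc L)} → IsVertex 3 L v →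
                 Bridge L (last u) (toList (tail u)) (toList v) (head v) → Connector u v
connector-long {u = _ ∷ us} {v = v₀ ∷ vs} (nr , v₀≢last) (bridge c refl lk cP cV) =
  c , ≤-refl , Linked-splice (_ ∷ c) lk (NoRepeat⇒Linked nr) , Apart-++ˡ (toList us) us-c v-side
  where
  V = v₀ ∷ toList vs
  us-c : Apart (toList us) (c ++ V)
  us-c = Apart-++ʳ c (Apart-sym c _ cP)
           (subst (λ xs → Apart xs V) (sym (drop-all _ (toList us) (≤-reflexive (length-toList us)))) [])
  c-v : Apart (c ++ V) V
  c-v = Apart-++ˡ c cV (subst (Apart V) (sym (drop-toList (v₀ ∷ vs))) (v₀≢last ∷ Apart-[]ʳ (toList vs)))
  v-side : Apart (c ++ V) (drop (length (toList us)) (c ++ V))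
  v-side = subst (Apart (c ++ V)) (sym (drop-++ c V (trans (+-identityʳ _) (sym (length-toList us))))) c-v

connector-short : ∀ {K} {u v : Word 3 (suc (suc K))} → IsVertex 3 (suc K) v → last u ≢ head v →
                  Bridge K (last u) (toList (tail u)) (toList (tail v)) (head v) → Connector u v
connector-short {u = _ ∷ us} {v = v₀ ∷ vs} (nr , v₀≢last) s≢v₀ (bridge c refl lk cP cV) =
  c , n≤1+n _ , Linked-splice (_ ∷ c) lk (NoRepeat⇒Linked nr) , Apart-++ˡ (toList us) us-c v-side
  where
  V = v₀ ∷ toList vs
  us-c : Apart (toList us) (c ++ V)
  us-c = Apart-++ʳ c (Apart-sym c _ cP) (subst (λ xs → Apart xs V) (sym (drop-toList us)) (s≢v₀ ∷ []))
  c-tail-v : Apart (c ++ V) (toList vs)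
  c-tail-v = Apart-++ˡ c cV (subst (Apart V) (sym (drop-toList vs)) (v₀≢last ∷ Apart-[]ʳ (toList vs)))
  v-side : Apart (c ++ V) (drop (length (toList us)) (c ++ V))
  v-side = subst (Apart (c ++ V)) (sym (drop-++ c V (trans (+-comm _ 1) (sym (length-toList us))))) c-tail-v

-- Slack at the first position comes from a collision among last u, u₁, v₀; failing that, from one
-- among last u, u₁, v₁ in the shorter bridge; failing both, v₁ itself is admissible first, and it
-- collides with the v₁ that the second position must avoid.
connector : ∀ {n} (u v : Word 3 (3 + n)) → IsVertex 3 (2 + n) v → Connector u v
connector u@(_ ∷ u₁ ∷ u₂ ∷ us) v@(v₀ ∷ v₁ ∷ vs) iv@(nr-∷ v₀≢v₁ _ , _) with collision? (last u) u₁ v₀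
... | yes col = connector-long {u = u} iv
        (bridge-slack col (≤-length-toList (u₂ ∷ us) ≤-refl) (≤-length-toList (v₁ ∷ vs) (n≤1+n _)))
... | no ¬col with collision? (last u) u₁ v₁
...   | yes col = connector-short {u = u} iv (¬col ∘ inj₂ ∘ inj₁)
        (bridge-slack col (≤-length-toList (u₂ ∷ us) (n≤1+n _)) (≤-length-toList vs (n≤1+n _)))
...   | no ¬col′ = connector-long {u = u} iv
        (bridge-∷ (≢-sym (¬col′ ∘ inj₂ ∘ inj₁)) (≢-sym (¬col′ ∘ inj₂ ∘ inj₂)) (≢-sym v₀≢v₁)
          (bridge-slack (inj₂ (inj₁ refl)) (≤-length-toList us ≤-refl) (≤-length-toList vs (n≤1+n _))))

lemma9 : (ℓ : ℕ) → 3 ≤ ℓ → DiameterLe 3 (ℓ ∸ 1) (2 * ℓ ∸ 1)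
lemma9 (suc (suc (suc n))) (s≤s (s≤s (s≤s _))) u v iu iv = connector⇒DistLe iu (connector u v iv)
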